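{- Let $n\ge 2$ and $t\ge 1$ be integers, and let $u$ be a vertex of $M(C_{2n})$ that is not a vertex of $C_{2n}$ (i.e., $u$ is one of the vertices inserted into the edges of $C_{2n}$). Then $$f_t(M(C_{2n}),u)\le 2^{n+1}+2n-2+(t-1)(2^n+n).$$
   Context: A pebbling move removes two pebbles from a vertex and places one pebble on an adjacent vertex. For a graph $G$ and vertex $u$, $f_t(G,u)$ is the smallest integer $N$ such that from every distribution of $N$ pebbles on the vertices of $G$ it is possible to move $t$ pebbles to $u$ by a sequence of pebbling moves. $C_{2n}$ is the cycle on $2n$ vertices. The middle graph $M(C_{2n})$ is obtained from $C_{2n}$ by inserting a new vertex into each edge (subdividing it) and joining two new vertices by an edge whenever the corresponding edges of $C_{2n}$ share an endpoint; the original vertices of $C_{2n}$ remain vertices of $M(C_{2n})$. -}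

module Defs where

open import Data.Nat using (ℕ; zero; suc; _+_; _*_; _∸_; _≤_)
open import Data.Fin using (Fin; toℕ)
import Data.Fin as F
open import Data.List using (List; map; allFin)
open import Data.Nat.ListAction using (sum)
open import Data.Product using (Σ; _×_; _,_; ∃)
open import Data.Sum using (_⊎_)
open import Relation.Nullary using (Dec; yes; no)
open import Relation.Nullary.Decidable using (map′)
open import Relation.Binary.PropositionalEquality using (_≡_; refl; cong)
open import Relation.Binary.Construct.Closure.ReflexiveTransitive using (Star)

CycSucc : (m : ℕ) → Fin m → Fin m → Set
CycSucc m i j = (suc (toℕ i) ≡ toℕ j) ⊎ ((suc (toℕ i) ≡ m) × (toℕ j ≡ 0))

-- Vertices of the middle graph M(C_m):
--   orig i : original vertex v_i of C_m
--   new  i : vertex inserted into the edge v_i v_{i+1} of C_m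
data MVertex (m : ℕ) : Set where
  orig : Fin m → MVertex m
  new  : Fin m → MVertex m

-- Edges of M(C_m) (one orientation each):
--   v_i — e_i, e_i — v_{i+1}  (subdivision of the edge v_i v_{i+1})
--   e_i — e_{i+1}             (consecutive edges of C_m share the endpoint v_{i+1})
data MEdge (m : ℕ) : MVertex m → MVertex m → Set where
  orig-new : (i : Fin m) → MEdge m (orig i) (new i)
  new-orig : (i j : Fin m) → CycSucc m i j → MEdge m (new i) (orig j)
  new-new  : (i j : Fin m) → CycSucc m i j → MEdge m (new i) (new j)

MAdj : (m : ℕ) → MVertex m → MVertex m → Set
MAdj m x y = MEdge m x y ⊎ MEdge m y x

_≟V_ : {m : ℕ} → (x y : MVertex m) → Dec (x ≡ y)
orig i ≟V orig j = map′ (cong orig) (λ { refl → refl }) (i F.≟ j)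
orig i ≟V new j = no (λ ())
new i ≟V orig j = no (λ ())
new i ≟V new j = map′ (cong new) (λ { refl → refl }) (i F.≟ j)

[_] : {A : Set} → Dec A → ℕ
[ yes _ ] = 1
[ no _ ] = 0

Dist : ℕ → Set
Dist m = MVertex m → ℕ

total : {m : ℕ} → Dist m → ℕ
total {m} D = sum (map (λ i → D (orig i)) (allFin m)) + sum (map (λ i → D (new i)) (allFin m))

moveDist : {m : ℕ} → Dist m → MVertex m → MVertex m → Dist m
moveDist D x y z = (D z ∸ 2 * [ z ≟V x ]) + [ z ≟V y ]

PebblingMove : (m : ℕ) → Dist m → Dist m → Set
PebblingMove m D D' =
  Σ (MVertex m) λ x → Σ (MVertex m) λ y →
    MAdj m x y × (2 ≤ D x) × (∀ z → D' z ≡ moveDist D x y z)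

Reachable : (m : ℕ) → Dist m → Dist m → Set
Reachable m = Star (PebblingMove m)

CanMove : (m : ℕ) → (t : ℕ) → MVertex m → Dist m → Set
CanMove m t u D = ∃ λ D' → Reachable m D D' × (t ≤ D' u)

-- Every distribution of N pebbles on M(C_m) can move t pebbles to u.
-- Since pebbling is monotone in the distribution, f_t(M(C_m),u) ≤ N
-- is equivalent to  AllSolvable m t u N.
AllSolvable : (m : ℕ) → (t : ℕ) → MVertex m → ℕ → Set
AllSolvable m t u N = (D : Dist m) → total D ≡ N → CanMove m t u D

-- Rotate so that the target is the vertex e₀ inserted into the edge v₀v₁, and split the
-- rest of M(C₂ₙ) into v₀, v₁ and two caterpillars ending at the antipodal inserted vertex eₙ:
-- paths of inserted vertices e₁…eₙ₋₁ and e₂ₙ₋₁…eₙ₊₁, each spine vertex carrying an original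
-- vertex as a leaf. Pebbles are pushed greedily towards e₀, halving at every edge; by
-- induction a caterpillar of length d holding c pebbles delivers V with
-- c + 1 ≤ 2ᵈ V + 2ᵈ + d, and adding up the rounding losses of the last halvings at e₀
-- yields the bound.
module Submission where

open import Defs
open import Data.Nat using (ℕ; zero; suc; _+_; _*_; _∸_; _^_; _≤_; _<_; z≤n; s≤s; NonZero; _/_; _%_)
open import Data.Nat.Properties
open import Data.Nat.DivMod using (_mod_; m≡m%n+[m/n]*n; m%n<n; m/n*n≤m; [m+kn]%n≡m%n; [m+n]%n≡m%n; m<n⇒m%n≡m; n%n≡0)
open import Data.Nat.ListAction using (sum)
open import Data.Nat.ListAction.Properties using (sum-++; sum-↭)
open import Data.Nat.Tactic.RingSolver using (solve-∀)
open import Data.Fin using (Fin; toℕ)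
import Data.Fin as Fin
open import Data.Fin.Properties using (toℕ-fromℕ<; toℕ-injective; toℕ<n)
import Data.Fin.Properties as Finₚ
open import Data.List using (List; []; _∷_; _++_; _∷ʳ_; map; tabulate; allFin; applyUpTo; applyDownFrom)
open import Data.List.Properties using (map-++; map-∘; map-tabulate; tabulate-cong; applyUpTo-∷ʳ; map-applyUpTo; reverse-applyUpTo)
open import Data.List.Relation.Binary.Permutation.Propositional using (_↭_; ↭-refl; ↭-sym; ↭-trans; prep; module PermutationReasoning)
open import Data.List.Relation.Binary.Permutation.Propositional.Properties using (map⁺; ++⁺; ++⁺ˡ; ∷↭∷ʳ; ↭-reverse)
open import Data.Product using (∃; _×_; _,_)
open import Data.Sum using (_⊎_; inj₁; inj₂; swap)
open import Data.Empty using (⊥-elim)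
open import Function using (_∘_; id)
open import Relation.Nullary using (Dec; yes; no)
open import Relation.Binary.PropositionalEquality hiding ([_])
open import Relation.Binary.Construct.Closure.ReflexiveTransitive using (ε; _◅_; _◅◅_)

≤-double-half : ∀ a → a ≤ 2 * (a / 2) + 1
≤-double-half a = begin
  a                 ≡⟨ m≡m%n+[m/n]*n a 2 ⟩
  a % 2 + a / 2 * 2 ≤⟨ +-monoˡ-≤ (a / 2 * 2) (≤-pred (m%n<n a 2)) ⟩
  1 + a / 2 * 2     ≡⟨ +-comm 1 (a / 2 * 2) ⟩
  a / 2 * 2 + 1     ≡⟨ cong (_+ 1) (*-comm (a / 2) 2) ⟩
  2 * (a / 2) + 1   ∎
  where open ≤-Reasoning

double-half-≤ : ∀ a → 2 * (a / 2) ≤ a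
double-half-≤ a = subst (_≤ a) (*-comm (a / 2) 2) (m/n*n≤m a 2)

swap-last : ∀ a b c → a + b + c ≡ a + c + b
swap-last = solve-∀

≤-scaled-double-half : ∀ {w} a → 1 ≤ w → a ≤ 2 * w * (a / 2) + 1
≤-scaled-double-half {w} a 1≤w =
  ≤-trans (≤-double-half a) (+-monoˡ-≤ 1 (*-monoˡ-≤ (a / 2) (*-monoʳ-≤ 2 1≤w)))

*-≤-scaled-double-half : ∀ w a → w * a ≤ 2 * w * (a / 2) + w
*-≤-scaled-double-half w a = begin
  w * a                 ≤⟨ *-monoʳ-≤ w (≤-double-half a) ⟩
  w * (2 * (a / 2) + 1) ≡⟨ expand w (a / 2) ⟩
  2 * w * (a / 2) + w   ∎
  where
  open ≤-Reasoning
  expand : ∀ w q → w * (2 * q + 1) ≡ 2 * w * q + w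
  expand = solve-∀

≤-scaled-double : ∀ {w} a → 1 ≤ w → a ≤ 2 * w * a
≤-scaled-double {w} a 1≤w =
  subst (_≤ 2 * w * a) (*-identityˡ a) (*-monoˡ-≤ a (≤-trans 1≤w (m≤m+n w (w + 0))))

forwarding-step : ∀ d F C a b k → C + k ≤ 2 ^ d * F + 2 ^ d + d →
                  a + b + C + k ≤ 2 ^ suc d * (a + b / 2 + F / 2) + 2 ^ suc d + suc d
forwarding-step d F C a b k bound = begin
  a + b + C + k
    ≡⟨ +-assoc (a + b) C k ⟩
  a + b + (C + k)
    ≤⟨ +-mono-≤ (+-mono-≤ (≤-scaled-double a 1≤p) (≤-scaled-double-half b 1≤p))
                (≤-trans bound (+-monoˡ-≤ d (+-monoˡ-≤ p (*-≤-scaled-double-half p F)))) ⟩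
  2 * p * a + (2 * p * (b / 2) + 1) + (2 * p * (F / 2) + p + p + d)
    ≡⟨ regroup p a (b / 2) (F / 2) d ⟩
  2 * p * (a + b / 2 + F / 2) + 2 * p + suc d ∎
  where
  open ≤-Reasoning
  p : ℕ
  p = 2 ^ d
  1≤p : 1 ≤ p
  1≤p = m^n>0 2 d
  regroup : ∀ p a b f d → 2 * p * a + (2 * p * b + 1) + (2 * p * f + p + p + d)
                        ≡ 2 * p * (a + b + f) + 2 * p + suc d
  regroup = solve-∀

[1+m]%n≡[1+m%n]%n : ∀ a n .{{_ : NonZero n}} → suc a % n ≡ suc (a % n) % n
[1+m]%n≡[1+m%n]%n a n =
  trans (cong (λ b → suc b % n) (m≡m%n+[m/n]*n a n)) ([m+kn]%n≡m%n (suc (a % n)) (a / n) n)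

suc-% : ∀ a n .{{_ : NonZero n}} → (suc (a % n) ≡ suc a % n) ⊎ (suc (a % n) ≡ n × suc a % n ≡ 0)
suc-% a n with m≤n⇒m<n∨m≡n (m%n<n a n)
... | inj₁ 1+a%n<n = inj₁ (sym (trans ([1+m]%n≡[1+m%n]%n a n) (m<n⇒m%n≡m 1+a%n<n)))
... | inj₂ 1+a%n≡n =
  inj₂ (1+a%n≡n , trans ([1+m]%n≡[1+m%n]%n a n) (trans (cong (_% n) 1+a%n≡n) (n%n≡0 n)))

module _ {a} {A : Set a} where

  sum-map-++ : ∀ (g : A → ℕ) xs ys → sum (map g (xs ++ ys)) ≡ sum (map g xs) + sum (map g ys)
  sum-map-++ g xs ys = trans (cong sum (map-++ g xs ys)) (sum-++ (map g xs) (map g ys))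

  sum-map-↭ : ∀ (g : A → ℕ) {xs ys} → xs ↭ ys → sum (map g xs) ≡ sum (map g ys)
  sum-map-↭ g xs↭ys = sum-↭ (map⁺ g xs↭ys)

  applyUpTo-cong : ∀ {f g : ℕ → A} → (∀ j → f j ≡ g j) → ∀ n → applyUpTo f n ≡ applyUpTo g n
  applyUpTo-cong f≗g zero = refl
  applyUpTo-cong f≗g (suc n) = cong₂ _∷_ (f≗g 0) (applyUpTo-cong (f≗g ∘ suc) n)

  applyUpTo-++ : ∀ (f : ℕ → A) a b → applyUpTo f (a + b) ≡ applyUpTo f a ++ applyUpTo (λ j → f (a + j)) b
  applyUpTo-++ f zero b = refl
  applyUpTo-++ f (suc a) b = cong (f 0 ∷_) (applyUpTo-++ (f ∘ suc) a b)

  applyUpTo-tabulate : ∀ {n} (g : ℕ → A) (f : Fin n → A) → (∀ k → g (toℕ k) ≡ f k) →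
                       applyUpTo g n ≡ tabulate f
  applyUpTo-tabulate {zero} g f g≗f = refl
  applyUpTo-tabulate {suc n} g f g≗f =
    cong₂ _∷_ (g≗f Fin.zero) (applyUpTo-tabulate (g ∘ suc) (f ∘ Fin.suc) (g≗f ∘ Fin.suc))

  applyDownFrom-↭ : ∀ (f : ℕ → A) n → applyDownFrom f n ↭ applyUpTo f n
  applyDownFrom-↭ f n = subst (_↭ applyUpTo f n) (reverse-applyUpTo f n) (↭-reverse (applyUpTo f n))

  applyUpTo-rotate : ∀ (f : ℕ → A) n → f n ≡ f 0 → applyUpTo (f ∘ suc) n ↭ applyUpTo f n
  applyUpTo-rotate f zero _ = ↭-refl
  applyUpTo-rotate f (suc n) fn≡f0 =
    subst (_↭ applyUpTo f (suc n))
      (trans (cong (applyUpTo (f ∘ suc) n ∷ʳ_) (sym fn≡f0)) (applyUpTo-∷ʳ (f ∘ suc) n))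
      (↭-sym (∷↭∷ʳ (f 0) (applyUpTo (f ∘ suc) n)))

  applyUpTo-shift : ∀ (f : ℕ → A) n → (∀ j → f (j + n) ≡ f j) →
                    ∀ c → applyUpTo (λ j → f (c + j)) n ↭ applyUpTo f n
  applyUpTo-shift f n periodic zero = ↭-refl
  applyUpTo-shift f n periodic (suc c) =
    ↭-trans (subst (_↭ applyUpTo fc n) (applyUpTo-cong (λ j → cong f (+-suc c j)) n)
                   (applyUpTo-rotate fc n (trans (periodic c) (cong f (sym (+-identityʳ c))))))
            (applyUpTo-shift f n periodic c)
    where
    fc : ℕ → A
    fc j = f (c + j)

[x≟x]≡1 : ∀ {m} (x : MVertex m) → [ x ≟V x ] ≡ 1
[x≟x]≡1 x with x ≟V x
... | yes _ = refl
... | no x≢x = ⊥-elim (x≢x refl)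

[]-⇔ : ∀ {A B : Set} (a : Dec A) (b : Dec B) → (A → B) → (B → A) → [ a ] ≡ [ b ]
[]-⇔ (yes _) (yes _) _ _ = refl
[]-⇔ (yes a) (no ¬b) a→b _ = ⊥-elim (¬b (a→b a))
[]-⇔ (no ¬a) (yes b) _ b→a = ⊥-elim (¬a (b→a b))
[]-⇔ (no _) (no _) _ _ = refl

sum-tabulate-zero : ∀ n → sum (tabulate {n = n} (λ _ → 0)) ≡ 0
sum-tabulate-zero zero = refl
sum-tabulate-zero (suc n) = sum-tabulate-zero n

sum-tabulate-indicator : ∀ {n} (k : Fin n) (h : Fin n → ℕ) →
                         sum (tabulate (λ f → [ k Fin.≟ f ] * h f)) ≡ h k
sum-tabulate-indicator {suc n} Fin.zero h =
  trans (cong (h Fin.zero + 0 +_) (sum-tabulate-zero n)) (trans (+-identityʳ _) (+-identityʳ _))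
sum-tabulate-indicator {suc n} (Fin.suc k) h =
  trans (cong sum (tabulate-cong (λ f → cong (_* h (Fin.suc f)) [suc≟suc])))
        (sum-tabulate-indicator k (h ∘ Fin.suc))
  where
  [suc≟suc] : ∀ {f} → [ Fin.suc k Fin.≟ Fin.suc f ] ≡ [ k Fin.≟ f ]
  [suc≟suc] {f} = []-⇔ (Fin.suc k Fin.≟ Fin.suc f) (k Fin.≟ f) Finₚ.suc-injective (cong Fin.suc)

[orig≟orig] : ∀ {m} (k f : Fin m) → [ orig k ≟V orig f ] ≡ [ k Fin.≟ f ]
[orig≟orig] k f = []-⇔ (orig k ≟V orig f) (k Fin.≟ f) (λ { refl → refl }) (cong orig)

[new≟new] : ∀ {m} (k f : Fin m) → [ new k ≟V new f ] ≡ [ k Fin.≟ f ]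
[new≟new] k f = []-⇔ (new k ≟V new f) (k Fin.≟ f) (λ { refl → refl }) (cong new)

vertices : (m : ℕ) → List (MVertex m)
vertices m = map orig (allFin m) ++ map new (allFin m)

sum-map-allFin : ∀ {n} (g : Fin n → ℕ) → sum (map g (allFin n)) ≡ sum (tabulate g)
sum-map-allFin g = cong sum (map-tabulate id g)

sum-map-vertices : ∀ {m} (g : MVertex m → ℕ) →
                   sum (map g (vertices m)) ≡ sum (tabulate (g ∘ orig)) + sum (tabulate (g ∘ new))
sum-map-vertices {m} g = trans (sum-map-++ g (map orig (allFin m)) (map new (allFin m)))
  (cong₂ _+_ (trans (cong sum (sym (map-∘ (allFin m)))) (sum-map-allFin (g ∘ orig)))
             (trans (cong sum (sym (map-∘ (allFin m)))) (sum-map-allFin (g ∘ new))))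

total-vertices : ∀ {m} (D : Dist m) → total D ≡ sum (map D (vertices m))
total-vertices {m} D =
  trans (cong₂ _+_ (sum-map-allFin (D ∘ orig)) (sum-map-allFin (D ∘ new))) (sym (sum-map-vertices D))

module Pebbling (m : ℕ) where

  _⊕_ : Dist m → Dist m → Dist m
  (D ⊕ E) z = D z + E z
  infixl 6 _⊕_

  δ : MVertex m → ℕ → Dist m
  δ x k z = [ z ≟V x ] * k

  infix 4 _⇝_
  _⇝_ : Dist m → Dist m → Set
  D ⇝ E = ∃ λ D′ → Reachable m D D′ × (∀ z → E z ≤ D′ z)

  moveDist-lift : ∀ {D E G : Dist m} {x} y → 2 ≤ D x → (∀ z → D z + G z ≤ E z) →
                  ∀ z → moveDist D x y z + G z ≤ moveDist E x y z
  moveDist-lift {D} {E} {G} {x} y 2≤Dx D+G≤E z with z ≟V x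
  ... | yes refl = begin
    (D x ∸ 2) + [ x ≟V y ] + G x  ≡⟨ swap-last (D x ∸ 2) [ x ≟V y ] (G x) ⟩
    (D x ∸ 2) + G x + [ x ≟V y ]  ≡⟨ cong (_+ [ x ≟V y ]) (+-∸-comm (G x) 2≤Dx) ⟨
    (D x + G x ∸ 2) + [ x ≟V y ]  ≤⟨ +-monoˡ-≤ [ x ≟V y ] (∸-monoˡ-≤ 2 (D+G≤E x)) ⟩
    (E x ∸ 2) + [ x ≟V y ]        ∎
    where open ≤-Reasoning
  ... | no _ = begin
    D z + [ z ≟V y ] + G z  ≡⟨ swap-last (D z) [ z ≟V y ] (G z) ⟩
    D z + G z + [ z ≟V y ]  ≤⟨ +-monoˡ-≤ [ z ≟V y ] (D+G≤E z) ⟩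
    E z + [ z ≟V y ]        ∎
    where open ≤-Reasoning

  reachable-lift : ∀ {D D′ E G : Dist m} → Reachable m D D′ → (∀ z → D z + G z ≤ E z) →
                   ∃ λ E′ → Reachable m E E′ × (∀ z → D′ z + G z ≤ E′ z)
  reachable-lift {E = E} ε D+G≤E = E , ε , D+G≤E
  reachable-lift {E = E} {G} ((x , y , adj , 2≤Dx , D₁≡) ◅ D₁↠D′) D+G≤E
    with reachable-lift {E = moveDist E x y} {G} D₁↠D′ (λ z →
           subst (λ k → k + G z ≤ _) (sym (D₁≡ z)) (moveDist-lift y 2≤Dx D+G≤E z))
  ... | E′ , E₁↠E′ , D′+G≤E′ =
    E′ , (x , y , adj , ≤-trans 2≤Dx (≤-trans (m≤m+n _ (G x)) (D+G≤E x)) , (λ _ → refl)) ◅ E₁↠E′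
       , D′+G≤E′

  ⇝-≤ : ∀ {D E} → (∀ z → E z ≤ D z) → D ⇝ E
  ⇝-≤ {D} E≤D = D , ε , E≤D

  ⇝-refl : ∀ {D} → D ⇝ D
  ⇝-refl = ⇝-≤ (λ _ → ≤-refl)

  ⇝-≡ : ∀ {D E} → (∀ z → D z ≡ E z) → D ⇝ E
  ⇝-≡ D≡E = ⇝-≤ (λ z → ≤-reflexive (sym (D≡E z)))

  ⇝-trans : ∀ {D E F} → D ⇝ E → E ⇝ F → D ⇝ F
  ⇝-trans (D′ , D↠D′ , E≤D′) (E′ , E↠E′ , F≤E′)
    with reachable-lift {G = λ _ → 0} E↠E′ (λ z → subst (_≤ D′ z) (sym (+-identityʳ _)) (E≤D′ z))
  ... | D″ , D′↠D″ , E′≤D″ =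
    D″ , D↠D′ ◅◅ D′↠D″ , λ z → ≤-trans (F≤E′ z) (subst (_≤ D″ z) (+-identityʳ _) (E′≤D″ z))

  ⇝-+ : ∀ {D₁ E₁ D₂ E₂} → D₁ ⇝ E₁ → D₂ ⇝ E₂ → D₁ ⊕ D₂ ⇝ E₁ ⊕ E₂
  ⇝-+ {D₁} {E₁} {D₂} {E₂} (D₁′ , D₁↠D₁′ , E₁≤D₁′) (D₂′ , D₂↠D₂′ , E₂≤D₂′)
    with reachable-lift {E = D₁ ⊕ D₂} {D₂} D₁↠D₁′ (λ _ → ≤-refl)
  ... | X , D↠X , D₁′+D₂≤X
    with reachable-lift {E = X} {D₁′} D₂↠D₂′ (λ z → subst (_≤ X z) (+-comm (D₁′ z) (D₂ z)) (D₁′+D₂≤X z))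
  ... | Y , X↠Y , D₂′+D₁′≤Y =
    Y , D↠X ◅◅ X↠Y , λ z → ≤-trans (+-mono-≤ (E₁≤D₁′ z) (E₂≤D₂′ z))
                                    (subst (_≤ Y z) (+-comm (D₂′ z) (D₁′ z)) (D₂′+D₁′≤Y z))

  ⇝-move : ∀ {x y} → MAdj m x y → δ x 2 ⇝ δ y 1
  ⇝-move {x} {y} adj = moveDist (δ x 2) x y , (x , y , adj , 2≤δx , λ _ → refl) ◅ ε , δy≤
    where
    2≤δx : 2 ≤ δ x 2 x
    2≤δx = ≤-reflexive (sym (cong (_* 2) ([x≟x]≡1 x)))
    δy≤ : ∀ z → δ y 1 z ≤ moveDist (δ x 2) x y z
    δy≤ z = subst (_≤ moveDist (δ x 2) x y z) (sym (*-identityʳ [ z ≟V y ])) (m≤n+m [ z ≟V y ] _)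

  ⇝-move-many : ∀ {x y} → MAdj m x y → ∀ q → δ x (2 * q) ⇝ δ y q
  ⇝-move-many {x} {y} adj zero = ⇝-≡ (λ z → trans (*-zeroʳ [ z ≟V x ]) (sym (*-zeroʳ [ z ≟V y ])))
  ⇝-move-many {x} {y} adj (suc q) =
    ⇝-trans (⇝-≡ (λ z → split [ z ≟V x ] q))
      (⇝-trans (⇝-+ (⇝-move adj) (⇝-move-many adj q)) (⇝-≡ (λ z → sym (split′ [ z ≟V y ] q))))
    where
    split : ∀ a q → a * (2 * suc q) ≡ a * 2 + a * (2 * q)
    split = solve-∀
    split′ : ∀ a q → a * suc q ≡ a * 1 + a * q
    split′ = solve-∀

  ⇝-move-half : ∀ {x y} → MAdj m x y → ∀ a → δ x a ⇝ δ y (a / 2)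
  ⇝-move-half {x} adj a =
    ⇝-trans (⇝-≤ (λ z → *-monoʳ-≤ [ z ≟V x ] (double-half-≤ a))) (⇝-move-many adj (a / 2))

  ⇝⇒CanMove : ∀ {D u t} → D ⇝ δ u t → CanMove m t u D
  ⇝⇒CanMove {u = u} {t} (D′ , D↠D′ , δ≤D′) =
    D′ , D↠D′ , subst (_≤ D′ u) (trans (cong (_* t) ([x≟x]≡1 u)) (*-identityˡ t)) (δ≤D′ u)

  restrict : Dist m → List (MVertex m) → Dist m
  restrict D xs z = sum (map (λ x → δ x (D x) z) xs)

  restrict-vertices : ∀ D z → restrict D (vertices m) z ≡ D z
  restrict-vertices D (orig k) = begin
    restrict D (vertices m) (orig k)
      ≡⟨ sum-map-vertices (λ x → δ x (D x) (orig k)) ⟩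
    sum (tabulate (λ f → [ orig k ≟V orig f ] * D (orig f))) + sum (tabulate {n = m} (λ _ → 0))
      ≡⟨ cong₂ _+_ (cong sum (tabulate-cong (λ f → cong (_* D (orig f)) ([orig≟orig] k f))))
                   (sum-tabulate-zero m) ⟩
    sum (tabulate (λ f → [ k Fin.≟ f ] * D (orig f))) + 0
      ≡⟨ trans (+-identityʳ _) (sum-tabulate-indicator k (D ∘ orig)) ⟩
    D (orig k) ∎
    where open ≡-Reasoning
  restrict-vertices D (new k) = begin
    restrict D (vertices m) (new k)
      ≡⟨ sum-map-vertices (λ x → δ x (D x) (new k)) ⟩
    sum (tabulate {n = m} (λ _ → 0)) + sum (tabulate (λ f → [ new k ≟V new f ] * D (new f)))
      ≡⟨ cong₂ _+_ (sum-tabulate-zero m)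
                   (cong sum (tabulate-cong (λ f → cong (_* D (new f)) ([new≟new] k f)))) ⟩
    sum (tabulate (λ f → [ k Fin.≟ f ] * D (new f)))
      ≡⟨ sum-tabulate-indicator k (D ∘ new) ⟩
    D (new k) ∎
    where open ≡-Reasoning

module Caterpillars (m : ℕ) where

  open Pebbling m

  -- Caterpillar τ d s: a path of d spine vertices from the head s to a neighbour of the
  -- tail τ, each spine vertex with a leaf attached.
  data Caterpillar (τ : MVertex m) : ℕ → MVertex m → Set where
    stem : Caterpillar τ 0 τ
    grow : ∀ {d h} s l → MAdj m l s → MAdj m h s → Caterpillar τ d h → Caterpillar τ (suc d) s

  module _ {τ : MVertex m} where

    spines leaves : ∀ {d s} → Caterpillar τ d s → List (MVertex m)
    spines stem = []
    spines (grow s _ _ _ c) = s ∷ spines c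
    leaves stem = []
    leaves (grow _ l _ _ c) = l ∷ leaves c

    delivered : Dist m → ℕ → ∀ {d s} → Caterpillar τ d s → ℕ
    delivered D T stem = T
    delivered D T (grow s l _ _ c) = D s + D l / 2 + delivered D T c / 2

    cargo : Dist m → ℕ → ∀ {d s} → Caterpillar τ d s → ℕ
    cargo D T c = sum (map D (spines c)) + sum (map D (leaves c)) + T

    cargo-grow : ∀ D T {d s l h} ls hs (c : Caterpillar τ d h) →
                 cargo D T (grow s l ls hs c) ≡ D s + D l + cargo D T c
    cargo-grow D T {s = s} {l} _ _ c =
      regroup (D s) (D l) (sum (map D (spines c))) (sum (map D (leaves c))) T
      where
      regroup : ∀ a b x y t → a + x + (b + y) + t ≡ a + b + (x + y + t)
      regroup = solve-∀

    delivered-⇝ : ∀ D T {d s} (c : Caterpillar τ d s) →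
                  restrict D (spines c) ⊕ restrict D (leaves c) ⊕ δ τ T ⇝ δ s (delivered D T c)
    delivered-⇝ D T stem = ⇝-refl
    delivered-⇝ D T (grow s l ls hs c) =
      ⇝-trans (⇝-≡ λ z → regroup (δ s (D s) z) (δ l (D l) z) _ _ _)
        (⇝-trans (⇝-+ (⇝-+ ⇝-refl (⇝-move-half ls (D l)))
                      (⇝-trans (delivered-⇝ D T c) (⇝-move-half hs _)))
                 (⇝-≡ λ z → merge [ z ≟V s ] (D s) (D l / 2) _))
      where
      regroup : ∀ a b x y t → a + x + (b + y) + t ≡ a + b + (x + y + t)
      regroup = solve-∀
      merge : ∀ i a b c → i * a + i * b + i * c ≡ i * (a + b + c)
      merge = solve-∀

    delivered-bound : ∀ D T {d s} (c : Caterpillar τ d s) →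
                      cargo D T c + 1 ≤ 2 ^ d * delivered D T c + 2 ^ d + d
    delivered-bound D T stem = ≤-reflexive (base T)
      where
      base : ∀ t → t + 1 ≡ 1 * t + 1 + 0
      base = solve-∀
    delivered-bound D T {suc d} (grow s l ls hs c) =
      ≤-trans (≤-reflexive (cong (_+ 1) (cargo-grow D T ls hs c)))
        (forwarding-step d _ _ (D s) (D l) 1 (delivered-bound D T c))

    -- An empty tail buys one unit of slack over delivered-bound, which the final count needs.
    delivered-bound₀ : ∀ D {d s} (c : Caterpillar τ (suc d) s) →
                       cargo D 0 c + 2 ≤ 2 ^ suc d * delivered D 0 c + 2 ^ suc d + suc d
    delivered-bound₀ D (grow s l ls hs stem) =
      ≤-trans (≤-reflexive (cong (_+ 2) (cargo-grow D 0 ls hs stem))) (begin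
        D s + D l + 0 + 2                        ≤⟨ +-monoˡ-≤ 2 (+-monoˡ-≤ 0
                                                      (+-mono-≤ (m≤m+n (D s) (D s)) (≤-double-half (D l)))) ⟩
        D s + D s + (2 * (D l / 2) + 1) + 0 + 2 ≡⟨ regroup (D s) (D l / 2) ⟩
        2 * (D s + D l / 2 + 0) + 2 + 1         ∎)
      where
      open ≤-Reasoning
      regroup : ∀ a q → a + a + (2 * q + 1) + 0 + 2 ≡ 2 * (a + q + 0) + 2 + 1
      regroup = solve-∀
    delivered-bound₀ D {suc d} (grow s l ls hs c@(grow _ _ _ _ _)) =
      ≤-trans (≤-reflexive (cong (_+ 2) (cargo-grow D 0 ls hs c)))
        (forwarding-step (suc d) _ _ (D s) (D l) 2 (delivered-bound₀ D c))

  descending : (σ λ′ : ℕ → MVertex m) → (∀ j → MAdj m (λ′ j) (σ j)) → (∀ j → MAdj m (σ (suc j)) (σ j)) →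
               ∀ d → Caterpillar (σ d) d (σ 0)
  descending σ λ′ leaf-adj spine-adj zero = stem
  descending σ λ′ leaf-adj spine-adj (suc d) =
    grow (σ 0) (λ′ 0) (leaf-adj 0) (spine-adj 0)
         (descending (σ ∘ suc) (λ′ ∘ suc) (leaf-adj ∘ suc) (spine-adj ∘ suc) d)

  ascending : (σ λ′ : ℕ → MVertex m) → (∀ j → MAdj m (λ′ j) (σ j)) → (∀ j → MAdj m (σ j) (σ (suc j))) →
              ∀ d → Caterpillar (σ 0) d (σ d)
  ascending σ λ′ leaf-adj spine-adj zero = stem
  ascending σ λ′ leaf-adj spine-adj (suc d) =
    grow (σ (suc d)) (λ′ (suc d)) (leaf-adj (suc d)) (spine-adj d) (ascending σ λ′ leaf-adj spine-adj d)

  descending-spines : ∀ σ λ′ la sa d → spines (descending σ λ′ la sa d) ≡ applyUpTo σ d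
  descending-spines σ λ′ la sa zero = refl
  descending-spines σ λ′ la sa (suc d) =
    cong (σ 0 ∷_) (descending-spines (σ ∘ suc) (λ′ ∘ suc) (la ∘ suc) (sa ∘ suc) d)

  descending-leaves : ∀ σ λ′ la sa d → leaves (descending σ λ′ la sa d) ≡ applyUpTo λ′ d
  descending-leaves σ λ′ la sa zero = refl
  descending-leaves σ λ′ la sa (suc d) =
    cong (λ′ 0 ∷_) (descending-leaves (σ ∘ suc) (λ′ ∘ suc) (la ∘ suc) (sa ∘ suc) d)

  ascending-spines : ∀ σ λ′ la sa d → spines (ascending σ λ′ la sa d) ≡ applyDownFrom (σ ∘ suc) d
  ascending-spines σ λ′ la sa zero = refl
  ascending-spines σ λ′ la sa (suc d) = cong (σ (suc d) ∷_) (ascending-spines σ λ′ la sa d)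

  ascending-leaves : ∀ σ λ′ la sa d → leaves (ascending σ λ′ la sa d) ≡ applyDownFrom (λ′ ∘ suc) d
  ascending-leaves σ λ′ la sa zero = refl
  ascending-leaves σ λ′ la sa (suc d) = cong (λ′ (suc d) ∷_) (ascending-leaves σ λ′ la sa d)

module Rotation (m : ℕ) .{{_ : NonZero m}} (i : Fin m) where

  -- e j is the vertex inserted into the edge v j — v (j + 1), indices counted from i mod m.
  idx : ℕ → Fin m
  idx j = (toℕ i + j) mod m

  e v : ℕ → MVertex m
  e = new ∘ idx
  v = orig ∘ idx

  toℕ-idx : ∀ j → toℕ (idx j) ≡ (toℕ i + j) % m
  toℕ-idx j = toℕ-fromℕ< _

  idx-0 : idx 0 ≡ i
  idx-0 = toℕ-injective
    (trans (toℕ-idx 0) (trans (cong (_% m) (+-identityʳ (toℕ i))) (m<n⇒m%n≡m (toℕ<n i))))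

  idx-periodic : ∀ j → idx (j + m) ≡ idx j
  idx-periodic j = toℕ-injective (begin
    toℕ (idx (j + m))       ≡⟨ toℕ-idx (j + m) ⟩
    (toℕ i + (j + m)) % m   ≡⟨ cong (_% m) (sym (+-assoc (toℕ i) j m)) ⟩
    (toℕ i + j + m) % m     ≡⟨ [m+n]%n≡m%n (toℕ i + j) m ⟩
    (toℕ i + j) % m         ≡⟨ sym (toℕ-idx j) ⟩
    toℕ (idx j)             ∎)
    where open ≡-Reasoning

  toℕ-idx-suc : ∀ j → toℕ (idx (suc j)) ≡ suc (toℕ i + j) % m
  toℕ-idx-suc j = trans (toℕ-idx (suc j)) (cong (_% m) (+-suc (toℕ i) j))

  idx-suc : ∀ j → CycSucc m (idx j) (idx (suc j))
  idx-suc j with suc-% (toℕ i + j) m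
  ... | inj₁ p = inj₁ (trans (cong suc (toℕ-idx j)) (trans p (sym (toℕ-idx-suc j))))
  ... | inj₂ (p , q) = inj₂ (trans (cong suc (toℕ-idx j)) p , trans (toℕ-idx-suc j) q)

  e-suc-adj : ∀ j → MAdj m (e (suc j)) (e j)
  e-suc-adj j = inj₂ (new-new (idx j) (idx (suc j)) (idx-suc j))

  v-suc-adj : ∀ j → MAdj m (v (suc j)) (e j)
  v-suc-adj j = inj₂ (new-orig (idx j) (idx (suc j)) (idx-suc j))

  v-adj : ∀ j → MAdj m (v j) (e j)
  v-adj j = inj₁ (orig-new (idx j))

  idx-↭ : applyUpTo idx m ↭ allFin m
  idx-↭ = subst (applyUpTo idx m ↭_) (applyUpTo-tabulate (_mod m) id mod-toℕ)
                (applyUpTo-shift (_mod m) m mod-periodic (toℕ i))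
    where
    mod-toℕ : ∀ (k : Fin m) → toℕ k mod m ≡ k
    mod-toℕ k = toℕ-injective (trans (toℕ-fromℕ< _) (m<n⇒m%n≡m (toℕ<n k)))
    mod-periodic : ∀ a → (a + m) mod m ≡ a mod m
    mod-periodic a =
      toℕ-injective (trans (toℕ-fromℕ< _) (trans ([m+n]%n≡m%n a m) (sym (toℕ-fromℕ< _))))

  rotated-↭ : applyUpTo v m ++ applyUpTo e m ↭ vertices m
  rotated-↭ = ++⁺ (subst (_↭ _) (map-applyUpTo idx orig m) (map⁺ orig idx-↭))
                  (subst (_↭ _) (map-applyUpTo idx new m) (map⁺ new idx-↭))

bound-closed-form : ∀ n′ t → 2 ^ (suc n′ + 1) + 2 * suc n′ ∸ 2 + (suc t ∸ 1) * (2 ^ suc n′ + suc n′)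
                           ≡ 4 * 2 ^ n′ + 2 * n′ + t * (2 * 2 ^ n′ + suc n′)
bound-closed-form n′ t = cong (_+ t * (2 * 2 ^ n′ + suc n′)) (begin
  2 ^ (suc n′ + 1) + 2 * suc n′ ∸ 2  ≡⟨ cong (λ a → 2 ^ suc a + 2 * suc n′ ∸ 2) (+-comm n′ 1) ⟩
  2 * (2 * 2 ^ n′) + 2 * suc n′ ∸ 2  ≡⟨ cong (_∸ 2) (regroup (2 ^ n′) n′) ⟩
  4 * 2 ^ n′ + 2 * n′ + 2 ∸ 2        ≡⟨ m+n∸n≡m _ 2 ⟩
  4 * 2 ^ n′ + 2 * n′                ∎)
  where
  open ≡-Reasoning
  regroup : ∀ q a → 2 * (2 * q) + 2 * suc a ≡ 4 * q + 2 * a + 2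
  regroup = solve-∀

gathering-bound : ∀ {p} n′ A x₀ x₁ cR cL VR VL → 1 ≤ p →
                  cR + 1 ≤ p * VR + p + n′ → cL + 2 ≤ p * VL + p + n′ →
                  A + x₀ + x₁ + cR + cL + 3
                    ≤ 2 * p * (A + x₀ / 2 + x₁ / 2 + VR / 2 + VL / 2) + 4 * p + 2 * n′ + 2
gathering-bound {p} n′ A x₀ x₁ cR cL VR VL 1≤p boundR boundL = begin
  A + x₀ + x₁ + cR + cL + 3
    ≡⟨ regroup₁ (A + x₀ + x₁) cR cL ⟩
  A + x₀ + x₁ + (cR + 1) + (cL + 2)
    ≤⟨ +-mono-≤ (+-mono-≤ (+-mono-≤ (+-mono-≤ (≤-scaled-double A 1≤p) (≤-scaled-double-half x₀ 1≤p))
                                    (≤-scaled-double-half x₁ 1≤p))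
                          (≤-trans boundR (halve VR)))
                (≤-trans boundL (halve VL)) ⟩
  2 * p * A + (2 * p * (x₀ / 2) + 1) + (2 * p * (x₁ / 2) + 1)
    + (2 * p * (VR / 2) + p + p + n′) + (2 * p * (VL / 2) + p + p + n′)
    ≡⟨ regroup₂ p n′ A (x₀ / 2) (x₁ / 2) (VR / 2) (VL / 2) ⟩
  2 * p * (A + x₀ / 2 + x₁ / 2 + VR / 2 + VL / 2) + 4 * p + 2 * n′ + 2 ∎
  where
  open ≤-Reasoning
  halve : ∀ V → p * V + p + n′ ≤ 2 * p * (V / 2) + p + p + n′
  halve V = +-monoˡ-≤ n′ (+-monoˡ-≤ p (*-≤-scaled-double-half p V))
  regroup₁ : ∀ s a b → s + a + b + 3 ≡ s + (a + 1) + (b + 2)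
  regroup₁ = solve-∀
  regroup₂ : ∀ p n a b c d e → 2 * p * a + (2 * p * b + 1) + (2 * p * c + 1)
                                 + (2 * p * d + p + p + n) + (2 * p * e + p + p + n)
                               ≡ 2 * p * (a + b + c + d + e) + 4 * p + 2 * n + 2
  regroup₂ = solve-∀

budget⇒< : ∀ p n′ t S G → S ≡ 4 * p + 2 * n′ + t * (2 * p + suc n′) →
           S + 3 ≤ 2 * p * G + 4 * p + 2 * n′ + 2 → t < G
budget⇒< p n′ t S G S≡ S+3≤ = *-cancelˡ-< (2 * p) t G (begin-strict
  2 * p * t               ≡⟨ *-comm (2 * p) t ⟩
  t * (2 * p)             ≤⟨ *-monoʳ-≤ t (m≤m+n (2 * p) (suc n′)) ⟩
  t * (2 * p + suc n′)    <⟨ +-cancelˡ-≤ (4 * p + 2 * n′ + 2) _ _ (begin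
      4 * p + 2 * n′ + 2 + suc (t * (2 * p + suc n′)) ≡⟨ regroup p n′ (t * (2 * p + suc n′)) ⟩
      4 * p + 2 * n′ + t * (2 * p + suc n′) + 3       ≡⟨ cong (_+ 3) (sym S≡) ⟩
      S + 3                                           ≤⟨ S+3≤ ⟩
      2 * p * G + 4 * p + 2 * n′ + 2                  ≡⟨ regroup′ p n′ G ⟩
      4 * p + 2 * n′ + 2 + 2 * p * G                  ∎) ⟩
  2 * p * G               ∎)
  where
  open ≤-Reasoning
  regroup : ∀ p n r → 4 * p + 2 * n + 2 + suc r ≡ 4 * p + 2 * n + r + 3
  regroup = solve-∀
  regroup′ : ∀ p n g → 2 * p * g + 4 * p + 2 * n + 2 ≡ 4 * p + 2 * n + 2 + 2 * p * g
  regroup′ = solve-∀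

module Gathering (k : ℕ) (i : Fin (2 * suc (suc k))) where

  n′ n m : ℕ
  n′ = suc k
  n = suc n′
  m = 2 * n

  open Pebbling m
  open Caterpillars m
  open Rotation m i

  eₗ vₗ : ℕ → MVertex m
  eₗ j = e (j + n)
  vₗ j = v (j + n)

  left-spine-adj : ∀ j → MAdj m (eₗ j) (eₗ (suc j))
  left-spine-adj j = swap (e-suc-adj (j + n))

  -- Both caterpillars have tail e n; its pebbles are sent along the right one.
  right : Caterpillar (e n) n′ (e 1)
  right = descending (e ∘ suc) (v ∘ (2 +_)) (v-suc-adj ∘ suc) (e-suc-adj ∘ suc) n′

  left : Caterpillar (e n) n′ (eₗ n′)
  left = ascending eₗ vₗ (v-adj ∘ (_+ n)) left-spine-adj n′

  left-head-adj : MAdj m (eₗ n′) (e 0)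
  left-head-adj = subst (MAdj m (eₗ n′)) eₗn≡e0 (left-spine-adj n′)
    where
    eₗn≡e0 : eₗ n ≡ e 0
    eₗn≡e0 = trans (cong (λ a → e (suc (n′ + suc a))) (sym (+-identityʳ n′))) (cong new (idx-periodic 0))

  right-spines : spines right ≡ applyUpTo (e ∘ suc) n′
  right-spines = descending-spines (e ∘ suc) (v ∘ (2 +_)) (v-suc-adj ∘ suc) (e-suc-adj ∘ suc) n′

  right-leaves : leaves right ≡ applyUpTo (v ∘ (2 +_)) n′
  right-leaves = descending-leaves (e ∘ suc) (v ∘ (2 +_)) (v-suc-adj ∘ suc) (e-suc-adj ∘ suc) n′

  left-spines : spines left ≡ applyDownFrom (eₗ ∘ suc) n′
  left-spines = ascending-spines eₗ vₗ (v-adj ∘ (_+ n)) left-spine-adj n′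

  left-leaves : leaves left ≡ applyDownFrom (vₗ ∘ suc) n′
  left-leaves = ascending-leaves eₗ vₗ (v-adj ∘ (_+ n)) left-spine-adj n′

  layout : List (MVertex m)
  layout = (v 0 ∷ v 1 ∷ leaves right ++ leaves left) ++ (e 0 ∷ spines right ++ e n ∷ spines left)

  layout-↭ : layout ↭ vertices m
  layout-↭ = ↭-trans (++⁺ v-part e-part) rotated-↭
    where
    open PermutationReasoning
    v-part : v 0 ∷ v 1 ∷ leaves right ++ leaves left ↭ applyUpTo v m
    v-part = begin
      v 0 ∷ v 1 ∷ leaves right ++ leaves left
        ≡⟨ cong₂ (λ xs ys → v 0 ∷ v 1 ∷ xs ++ ys) right-leaves left-leaves ⟩
      v 0 ∷ v 1 ∷ applyUpTo (v ∘ (2 +_)) n′ ++ applyDownFrom (vₗ ∘ suc) n′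
        ↭⟨ prep (v 0) (prep (v 1) (++⁺ˡ (applyUpTo (v ∘ (2 +_)) n′) (applyDownFrom-↭ _ n′))) ⟩
      v 0 ∷ v 1 ∷ applyUpTo (v ∘ (2 +_)) n′ ++ applyUpTo (vₗ ∘ suc) n′
        ≡⟨ cong (λ xs → v 0 ∷ v 1 ∷ applyUpTo (v ∘ (2 +_)) n′ ++ xs)
                (applyUpTo-cong (λ j → cong v (cong suc (trans (cong suc (+-comm n′ j)) (sym (+-suc j n′)))))
                                n′) ⟨
      v 0 ∷ v 1 ∷ applyUpTo (v ∘ (2 +_)) n′ ++ applyUpTo (λ j → v (2 + (n′ + j))) n′
        ≡⟨ cong (λ xs → v 0 ∷ v 1 ∷ xs) (applyUpTo-++ (v ∘ (2 +_)) n′ n′) ⟨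
      applyUpTo v (2 + (n′ + n′))
        ≡⟨ cong (applyUpTo v) (m≡ n′) ⟨
      applyUpTo v m ∎
      where
      m≡ : ∀ a → 2 * suc a ≡ 2 + (a + a)
      m≡ = solve-∀
    e-part : e 0 ∷ spines right ++ e n ∷ spines left ↭ applyUpTo e m
    e-part = begin
      e 0 ∷ spines right ++ e n ∷ spines left
        ≡⟨ cong₂ (λ xs ys → e 0 ∷ xs ++ e n ∷ ys) right-spines left-spines ⟩
      e 0 ∷ applyUpTo (e ∘ suc) n′ ++ e n ∷ applyDownFrom (eₗ ∘ suc) n′
        ↭⟨ prep (e 0) (++⁺ˡ (applyUpTo (e ∘ suc) n′) (prep (e n) (applyDownFrom-↭ _ n′))) ⟩
      applyUpTo e n ++ applyUpTo eₗ n
        ≡⟨ cong (applyUpTo e n ++_) (applyUpTo-cong (λ j → cong e (+-comm n j)) n) ⟨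
      applyUpTo e n ++ applyUpTo (λ j → e (n + j)) n
        ≡⟨ applyUpTo-++ e n n ⟨
      applyUpTo e (n + n)
        ≡⟨ cong (λ a → applyUpTo e (n + a)) (+-identityʳ n) ⟨
      applyUpTo e m ∎

  layout-sum : ∀ (g : MVertex m → ℕ) →
    sum (map g (vertices m)) ≡
    g (v 0) + (g (v 1) + (sum (map g (leaves right)) + sum (map g (leaves left))))
      + (g (e 0) + (sum (map g (spines right)) + (g (e n) + sum (map g (spines left)))))
  layout-sum g = trans (sym (sum-map-↭ g layout-↭))
    (trans (sum-map-++ g (v 0 ∷ v 1 ∷ leaves right ++ leaves left)
                         (e 0 ∷ spines right ++ e n ∷ spines left))
           (cong₂ (λ a b → g (v 0) + (g (v 1) + a) + (g (e 0) + b))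
                  (sum-map-++ g (leaves right) (leaves left))
                  (sum-map-++ g (spines right) (e n ∷ spines left))))

  gathered : Dist m → ℕ
  gathered D = D (e 0) + D (v 0) / 2 + D (v 1) / 2 + delivered D (D (e n)) right / 2 + delivered D 0 left / 2

  gather : ∀ D → D ⇝ δ (new i) (gathered D)
  gather D = subst (λ u → D ⇝ δ u (gathered D)) (cong new idx-0) (
    ⇝-trans (⇝-≡ split)
      (⇝-trans (⇝-+ (⇝-+ (⇝-+ (⇝-+ ⇝-refl (⇝-move-half (v-adj 0) (D (v 0))))
                                  (⇝-move-half (v-suc-adj 0) (D (v 1))))
                          (⇝-trans (delivered-⇝ D (D (e n)) right) (⇝-move-half (e-suc-adj 0) _)))
                    (⇝-trans (delivered-⇝ D 0 left) (⇝-move-half left-head-adj _)))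
               (⇝-≡ λ z → merge [ z ≟V e 0 ] (D (e 0)) _ _ _ _)))
    where
    split : ∀ z → D z ≡ (δ (e 0) (D (e 0)) ⊕ δ (v 0) (D (v 0)) ⊕ δ (v 1) (D (v 1))
                         ⊕ (restrict D (spines right) ⊕ restrict D (leaves right) ⊕ δ (e n) (D (e n)))
                         ⊕ (restrict D (spines left) ⊕ restrict D (leaves left) ⊕ δ (e n) 0)) z
    split z = trans (sym (restrict-vertices D z))
      (trans (layout-sum (λ x → δ x (D x) z))
             (regroup (δ (v 0) (D (v 0)) z) (δ (v 1) (D (v 1)) z)
                      (restrict D (leaves right) z) (restrict D (leaves left) z)
                      (δ (e 0) (D (e 0)) z) (restrict D (spines right) z)
                      (δ (e n) (D (e n)) z) (restrict D (spines left) z) [ z ≟V e n ]))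
      where
      regroup : ∀ a b lr ll c sr d sl i →
                a + (b + (lr + ll)) + (c + (sr + (d + sl))) ≡ c + a + b + (sr + lr + d) + (sl + ll + i * 0)
      regroup = solve-∀
    merge : ∀ i a b c d f → i * a + i * b + i * c + i * d + i * f ≡ i * (a + b + c + d + f)
    merge = solve-∀

  total-split : ∀ D → total D ≡ D (e 0) + D (v 0) + D (v 1) + cargo D (D (e n)) right + cargo D 0 left
  total-split D = trans (total-vertices D) (trans (layout-sum D)
    (regroup (D (v 0)) (D (v 1)) (sum (map D (leaves right))) (sum (map D (leaves left)))
             (D (e 0)) (sum (map D (spines right))) (D (e n)) (sum (map D (spines left)))))
    where
    regroup : ∀ a b lr ll c sr d sl →
              a + (b + (lr + ll)) + (c + (sr + (d + sl))) ≡ c + a + b + (sr + lr + d) + (sl + ll + 0)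
    regroup = solve-∀

  total⇒<gathered : ∀ D t → total D ≡ 2 ^ (n + 1) + 2 * n ∸ 2 + (suc t ∸ 1) * (2 ^ n + n) → t < gathered D
  total⇒<gathered D t total≡ =
    budget⇒< (2 ^ n′) n′ t _ _ (trans (sym (total-split D)) (trans total≡ (bound-closed-form n′ t)))
      (gathering-bound n′ (D (e 0)) (D (v 0)) (D (v 1)) _ _ _ _ (m^n>0 2 n′)
        (delivered-bound D (D (e n)) right) (delivered-bound₀ D left))

corollary3p1 : (n t : ℕ) → 2 ≤ n → 1 ≤ t → (i : Fin (2 * n)) →
    AllSolvable (2 * n) t (new i) (2 ^ (n + 1) + 2 * n ∸ 2 + (t ∸ 1) * (2 ^ n + n))
corollary3p1 (suc (suc k)) (suc t) (s≤s (s≤s z≤n)) (s≤s z≤n) i D total≡ =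
  ⇝⇒CanMove (⇝-trans (gather D) (⇝-≤ λ z → *-monoʳ-≤ [ z ≟V new i ] (total⇒<gathered D t total≡)))
  where
  open Gathering k i
  open Pebbling m
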